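{- Let $T,Q,R\in\mathbf T$ be pairwise compatible tilings. Then $R$ is compatible with $T\cap Q$ and with $T\cup Q$, and $R\cap(T\cup Q)=(R\cap T)\cup(R\cap Q)$.
   Context: Fix an integer $n\ge 2$, $[n]=\{1,\dots,n\}$, and let $\Lambda$ be the set of triples $ijk$ with $i<j<k$ in $[n]$. For a quadruple $i<j<k<l$, its stick is the ordered sequence $(ijk,ijl,ikl,jkl)$. A subset of $\Lambda$ is a pseudo-tiling; it is a tiling if for every quadruple $i<j<k<l$ its intersection with the stick, written as a 0/1 string along the stick order, is one of $0000,1000,1100,1110,1111,0111,0011,0001$ (these are the inversion sets of rhombus tilings of the zonogon $Z(n;2)$). $\mathbf T$ denotes the set of tilings. Two tilings $T,T'$ are compatible if both $T\cap T'$ and $T\cup T'$ are tilings. -}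

module Defs where

open import Data.Nat using (ℕ)
open import Data.Fin using (Fin; _<_)
open import Data.Bool using (Bool; true; false; _∧_; _∨_)
open import Data.Product using (_×_)
open import Data.Sum using (_⊎_)
open import Relation.Binary.PropositionalEquality using (_≡_)

-- A pseudo-tiling (subset of Λ = {ijk : i<j<k in [n]}) is represented by its
-- indicator on triples. Only the values at triples (i,j,k) with i < j < k are
-- meaningful; all notions below only inspect such triples.
PseudoTiling : ℕ → Set
PseudoTiling n = Fin n → Fin n → Fin n → Bool

_∩_ : ∀ {n} → PseudoTiling n → PseudoTiling n → PseudoTiling n
(A ∩ B) i j k = A i j k ∧ B i j k

_∪_ : ∀ {n} → PseudoTiling n → PseudoTiling n → PseudoTiling n
(A ∪ B) i j k = A i j k ∨ B i j k

infixr 7 _∩_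
infixr 6 _∪_

data Admissible : Bool → Bool → Bool → Bool → Set where
  a0000 : Admissible false false false false
  a1000 : Admissible true  false false false
  a1100 : Admissible true  true  false false
  a1110 : Admissible true  true  true  false
  a1111 : Admissible true  true  true  true
  a0111 : Admissible false true  true  true
  a0011 : Admissible false false true  true
  a0001 : Admissible false false false true

IsTiling : ∀ {n} → PseudoTiling n → Set
IsTiling {n} T = (i j k l : Fin n) → i < j → j < k → k < l →
  Admissible (T i j k) (T i j l) (T i k l) (T j k l)

Compatible : ∀ {n} → PseudoTiling n → PseudoTiling n → Set
Compatible T T' = IsTiling (T ∩ T') × IsTiling (T ∪ T')

_≐_ : ∀ {n} → PseudoTiling n → PseudoTiling n → Set
_≐_ {n} A B = (i j k : Fin n) → i < j → j < k → A i j k ≡ B i j k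

module Submission where

open import Defs
open import Data.Nat using (ℕ; _≤_)
open import Data.Fin using (Fin; _<_)
open import Data.Bool using (Bool; true; false; _∧_; _∨_)
open import Data.Bool.Properties using (∧-distribˡ-∨)
open import Data.Product using (_×_; _,_; proj₁; proj₂)
open import Data.List using (List; []; _∷_)
open import Data.List.Membership.Propositional using (_∈_)
open import Data.List.Relation.Unary.Any using (here; there)
open import Data.List.Relation.Unary.All as All using (All; all?)
open import Relation.Nullary using (Dec; yes; no)
open import Relation.Nullary.Decidable using (toWitness; _×-dec_; _→-dec_)
open import Relation.Binary.PropositionalEquality using (refl)

-- Every stick of T ∩ Q, T ∪ Q, R ∩ (T ∩ Q), … is computed from the sticks of
-- T, Q, R alone, so the theorem reduces to a statement about triples of
-- admissible 4-bit strings, of which there are only 8³; that statement is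
-- checked exhaustively.

Stick : Set
Stick = Bool × Bool × Bool × Bool

_⊓_ : Stick → Stick → Stick
(a , b , c , d) ⊓ (a′ , b′ , c′ , d′) = a ∧ a′ , b ∧ b′ , c ∧ c′ , d ∧ d′

_⊔_ : Stick → Stick → Stick
(a , b , c , d) ⊔ (a′ , b′ , c′ , d′) = a ∨ a′ , b ∨ b′ , c ∨ c′ , d ∨ d′

AdmissibleStick : Stick → Set
AdmissibleStick (a , b , c , d) = Admissible a b c d

CompatibleSticks : Stick → Stick → Set
CompatibleSticks s t = AdmissibleStick (s ⊓ t) × AdmissibleStick (s ⊔ t)

stickOf : ∀ {n} → PseudoTiling n → (i j k l : Fin n) → Stick
stickOf T i j k l = T i j k , T i j l , T i k l , T j k l

admissible? : ∀ s → Dec (AdmissibleStick s)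
admissible? (false , false , false , false) = yes a0000
admissible? (true  , false , false , false) = yes a1000
admissible? (true  , true  , false , false) = yes a1100
admissible? (true  , true  , true  , false) = yes a1110
admissible? (true  , true  , true  , true ) = yes a1111
admissible? (false , true  , true  , true ) = yes a0111
admissible? (false , false , true  , true ) = yes a0011
admissible? (false , false , false , true ) = yes a0001
admissible? (true  , false , true  , false) = no λ ()
admissible? (true  , false , false , true ) = no λ ()
admissible? (true  , false , true  , true ) = no λ ()
admissible? (true  , true  , false , true ) = no λ ()
admissible? (false , true  , false , false) = no λ ()
admissible? (false , true  , true  , false) = no λ ()
admissible? (false , true  , false , true ) = no λ ()
admissible? (false , false , true  , false) = no λ ()

compatible? : ∀ s t → Dec (CompatibleSticks s t)
compatible? s t = admissible? (s ⊓ t) ×-dec admissible? (s ⊔ t)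

admissibleSticks : List Stick
admissibleSticks =
  (false , false , false , false) ∷ (true  , false , false , false) ∷
  (true  , true  , false , false) ∷ (true  , true  , true  , false) ∷
  (true  , true  , true  , true ) ∷ (false , true  , true  , true ) ∷
  (false , false , true  , true ) ∷ (false , false , false , true ) ∷ []

admissible⇒∈admissibleSticks : ∀ {s} → AdmissibleStick s → s ∈ admissibleSticks
admissible⇒∈admissibleSticks {_ , _ , _ , _} a0000 = here refl
admissible⇒∈admissibleSticks {_ , _ , _ , _} a1000 = there (here refl)
admissible⇒∈admissibleSticks {_ , _ , _ , _} a1100 = there (there (here refl))
admissible⇒∈admissibleSticks {_ , _ , _ , _} a1110 = there (there (there (here refl)))
admissible⇒∈admissibleSticks {_ , _ , _ , _} a1111 = there (there (there (there (here refl))))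
admissible⇒∈admissibleSticks {_ , _ , _ , _} a0111 =
  there (there (there (there (there (here refl)))))
admissible⇒∈admissibleSticks {_ , _ , _ , _} a0011 =
  there (there (there (there (there (there (here refl))))))
admissible⇒∈admissibleSticks {_ , _ , _ , _} a0001 =
  there (there (there (there (there (there (there (here refl)))))))

MeetJoinCompatibility : Stick → Stick → Stick → Set
MeetJoinCompatibility s t u =
  CompatibleSticks s t → CompatibleSticks s u → CompatibleSticks t u →
  CompatibleSticks u (s ⊓ t) × CompatibleSticks u (s ⊔ t)

meetJoinCompatibility? :
  ∀ s t u → Dec (MeetJoinCompatibility s t u)
meetJoinCompatibility? s t u =
  compatible? s t →-dec compatible? s u →-dec compatible? t u →-dec
  (compatible? u (s ⊓ t) ×-dec compatible? u (s ⊔ t))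

meetJoinCompatibility-admissibleSticks :
  All (λ s → All (λ t → All (MeetJoinCompatibility s t)
                                admissibleSticks)
                 admissibleSticks)
      admissibleSticks
meetJoinCompatibility-admissibleSticks = toWitness
  {a? = all? (λ s → all? (λ t → all? (meetJoinCompatibility? s t) admissibleSticks)
                         admissibleSticks)
             admissibleSticks} _

compatible-meet-join : ∀ {s t u} →
  AdmissibleStick s → AdmissibleStick t → AdmissibleStick u →
  MeetJoinCompatibility s t u
compatible-meet-join s-adm t-adm u-adm =
  All.lookup (All.lookup (All.lookup meetJoinCompatibility-admissibleSticks
    (admissible⇒∈admissibleSticks s-adm)) (admissible⇒∈admissibleSticks t-adm))
    (admissible⇒∈admissibleSticks u-adm)

lemma1 : (n : ℕ) → 2 ≤ n → (T Q R : PseudoTiling n) →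
    IsTiling T → IsTiling Q → IsTiling R →
    Compatible T Q → Compatible T R → Compatible Q R →
    Compatible R (T ∩ Q) × Compatible R (T ∪ Q) ×
    (R ∩ (T ∪ Q)) ≐ ((R ∩ T) ∪ (R ∩ Q))
lemma1 n _ T Q R T-tiling Q-tiling R-tiling (TQ∩ , TQ∪) (TR∩ , TR∪) (QR∩ , QR∪) =
  ( (λ i j k l p q r → proj₁ (proj₁ (onStick i j k l p q r)))
  , (λ i j k l p q r → proj₂ (proj₁ (onStick i j k l p q r))) )
  , ( (λ i j k l p q r → proj₁ (proj₂ (onStick i j k l p q r)))
  , (λ i j k l p q r → proj₂ (proj₂ (onStick i j k l p q r))) )
  , λ i j k _ _ → ∧-distribˡ-∨ (R i j k) (T i j k) (Q i j k)
  where
  onStick : (i j k l : Fin n) → i < j → j < k → k < l →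
    CompatibleSticks (stickOf R i j k l) (stickOf T i j k l ⊓ stickOf Q i j k l) ×
    CompatibleSticks (stickOf R i j k l) (stickOf T i j k l ⊔ stickOf Q i j k l)
  onStick i j k l p q r =
    compatible-meet-join (T-tiling i j k l p q r) (Q-tiling i j k l p q r)
      (R-tiling i j k l p q r)
      (TQ∩ i j k l p q r , TQ∪ i j k l p q r)
      (TR∩ i j k l p q r , TR∪ i j k l p q r)
      (QR∩ i j k l p q r , QR∪ i j k l p q r)
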